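{- Let $p$ be a positive integer, let $\Lambda\subseteq\mathbf{F}_2^n$ belong to the family $\mathbf{\Lambda}(2p)$, and let $E_1,\dots,E_{2p}\subseteq\Lambda$. Let $\mathcal{C}_1,\dots,\mathcal{C}_r$ be a partition of $[2p]$. For $S^*\subseteq[2p]$ with $|S^*|=p$ and $\bar S^*=[2p]\setminus S^*$, let $M(S^*)$ be the $p\times p$ matrix with rows indexed by $i\in S^*$, columns indexed by $j\in\bar S^*$, and entries $m_{ij}=|E_i\cap E_j|$. Then the number of tuples $(\lambda_1,\dots,\lambda_{2p})$ with $\lambda_i\in E_i$ for all $i$ and $\lambda_1+\dots+\lambda_{2p}=0$ is at most $$\sum_{S^*}\operatorname{per}M(S^*),$$ where the sum is over all $S^*\subseteq[2p]$ with $|S^*|=p$ such that $S^*$ contains at least one element of every class $\mathcal{C}_i$ with $|\mathcal{C}_i|\ge 2$.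
   Context: A set $\Lambda=\{\lambda_1,\dots,\lambda_{|\Lambda|}\}\subseteq\mathbf{F}_2^n$ belongs to the family $\mathbf{\Lambda}(k)$ if whenever $\sum_i\varepsilon_i\lambda_i=0$ with $\varepsilon_i\in\{ -1,0,1\}$ and $\sum_i|\varepsilon_i|\le k$, all $\varepsilon_i$ are zero. For a square matrix $(m_{ij})_{i\in I,j\in J}$ with $|I|=|J|$, $\operatorname{per}$ denotes the permanent $\sum_{\sigma}\prod_{i\in I}m_{i\sigma(i)}$ over all bijections $\sigma:I\to J$. -}

module Defs where

open import Data.Bool using (Bool; true; false; _xor_)
open import Data.Nat using (ℕ; zero; suc; _+_; _*_; _≤_)
open import Data.Fin using (Fin; _≟_)
open import Data.Fin.Subset using (Subset; _∈_; _∩_; ∣_∣)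
open import Data.Fin.Subset.Properties using (_∈?_)
open import Data.Fin.Properties using (all?; any?)
open import Data.List using (List; []; _∷_; map; concatMap; filter; filterᵇ; zipWith; length; allFin; foldr)
open import Data.Nat.ListAction using (sum; product)
open import Data.List.Relation.Unary.Unique.Propositional using (Unique)
import Data.List.Relation.Unary.Unique.DecPropositional as UD
open import Data.Vec using (Vec; lookup; replicate; zipWith; tabulate)
import Data.Vec
open import Data.Vec.Properties using (≡-dec)
import Data.Bool.Properties as BP
open import Data.Product using (_×_; ∃; _,_)
open import Relation.Binary.PropositionalEquality using (_≡_)
open import Relation.Nullary using (Dec; _×-dec_; _→-dec_; ¬?)
open import Relation.Nullary.Decidable using (does)

F₂^ : ℕ → Set
F₂^ n = Vec Bool n

0v : ∀ {n} → F₂^ n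
0v = replicate _ false

infixl 6 _⊕_
_⊕_ : ∀ {n} → F₂^ n → F₂^ n → F₂^ n
_⊕_ = Data.Vec.zipWith _xor_

Σv : ∀ {n k} → (Fin k → F₂^ n) → F₂^ n
Σv {k = k} f = foldr (λ i acc → f i ⊕ acc) 0v (allFin k)

Σℕ : ∀ {k} → (Fin k → ℕ) → ℕ
Σℕ {k} f = sum (map f (allFin k))

data Sign : Set where
  -1ₛ 0ₛ 1ₛ : Sign

absₛ : Sign → ℕ
absₛ -1ₛ = 1
absₛ 0ₛ  = 0
absₛ 1ₛ  = 1

-- ε · v in F₂ⁿ (note -1 = 1 in F₂).
_·_ : ∀ {n} → Sign → F₂^ n → F₂^ n
-1ₛ · v = v
0ₛ  · v = 0v
1ₛ  · v = v

-- Λ = {λ_1,…,λ_m} (enumerated by λ : Fin m → F₂ⁿ) is in the family Λ(k).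
InΛ : ∀ {n m} → ℕ → (Fin m → F₂^ n) → Set
InΛ {m = m} k λv =
  (ε : Fin m → Sign) →
  Σℕ (λ i → absₛ (ε i)) ≤ k →
  Σv (λ i → ε i · λv i) ≡ 0v →
  ∀ i → ε i ≡ 0ₛ

vecsOver : ∀ {A : Set} → List A → (k : ℕ) → List (Vec A k)
vecsOver xs zero    = Data.Vec.[] ∷ []
vecsOver xs (suc k) = concatMap (λ x → map (x Data.Vec.∷_) (vecsOver xs k)) xs

listsOver : ∀ {A : Set} → List A → (k : ℕ) → List (List A)
listsOver xs k = map Data.Vec.toList (vecsOver xs k)

elems : ∀ {N} → Subset N → List (Fin N)
elems {N} S = filter (_∈? S) (allFin N)

allSubsets : (N : ℕ) → List (Subset N)
allSubsets N = vecsOver (true ∷ false ∷ []) N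

-- Permanent of the matrix (m i j)_{i ∈ I, j ∈ J}, I, J given as lists of
-- distinct indices with |I| = |J|: sum over all bijections σ : I → J
-- (listed as the images of the elements of I, in order, which must be
-- distinct elements of J) of ∏_{i ∈ I} m i (σ i).

per : ∀ {N} → (I J : List (Fin N)) → (Fin N → Fin N → ℕ) → ℕ
per I J m =
  sum (map (λ σ → product (Data.List.zipWith m I σ))
           (filter (UD.unique? _≟_) (listsOver J (length I))))

perM : ∀ {p m} → (E : Fin (p + p) → Subset m) → Subset (p + p) → ℕ
perM E S = per (elems S) (elems (Data.Fin.Subset.∁ S)) (λ i j → ∣ E i ∩ E j ∣)

-- Class of a : the set of i with c i = a (c : Fin N → Fin r encodes the
-- partition C_1, …, C_r of [N]).

Class : ∀ {N r} → (Fin N → Fin r) → Fin r → Subset N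
Class c a = tabulate (λ i → does (c i ≟ a))

Admissible : ∀ {N r} → (Fin N → Fin r) → Subset N → Set
Admissible c S = ∀ a → 2 ≤ ∣ Class c a ∣ → ∃ λ i → i ∈ S × c i ≡ a

admissible? : ∀ {N r} (c : Fin N → Fin r) (S : Subset N) → Dec (Admissible c S)
admissible? c S = all? λ a → (2 Data.Nat.≤? ∣ Class c a ∣) →-dec any? (λ i → (i ∈? S) ×-dec (c i ≟ a))

goodSubsets : ∀ {r} (p : ℕ) → (Fin (p + p) → Fin r) → List (Subset (p + p))
goodSubsets p c =
  filter (λ S → (∣ S ∣ Data.Nat.≟ p) ×-dec admissible? c S) (allSubsets (p + p))

RHS : ∀ {m r} (p : ℕ) → (E : Fin (p + p) → Subset m) → (Fin (p + p) → Fin r) → ℕ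
RHS p E c = sum (map (perM {p} E) (goodSubsets p c))

-- Tuples (λ_1,…,λ_{2p}) with λ_i ∈ E_i and Σ λ_i = 0; a tuple is given
-- by the indices t i ∈ Fin m of its entries λ (t i) ∈ Λ.

GoodTuple : ∀ {n m k} → (Fin m → F₂^ n) → (Fin k → Subset m) → Vec (Fin m) k → Set
GoodTuple λv E t = (∀ i → lookup t i ∈ E i) × Σv (λ i → λv (lookup t i)) ≡ 0v

goodTuple? : ∀ {n m k} (λv : Fin m → F₂^ n) (E : Fin k → Subset m) (t : Vec (Fin m) k) →
             Dec (GoodTuple λv E t)
goodTuple? λv E t = all? (λ i → lookup t i ∈? E i) ×-dec ≡-dec BP._≟_ _ _

numTuples : ∀ {n m k} → (Fin m → F₂^ n) → (Fin k → Subset m) → ℕ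
numTuples {m = m} {k} λv E = length (filter (goodTuple? λv E) (vecsOver (allFin m) k))

{-# OPTIONS --safe #-}

-- If λ_1 + ⋯ + λ_{2p} = 0 with Λ ∈ Λ(2p), every element of Λ occurs an even
-- number of times in the tuple: the elements of odd multiplicity would give a
-- vanishing sum of at most 2p distinct elements of Λ. Hence the positions [2p]
-- split into pairs carrying equal values. Removing one pair at a time, and
-- merging the classes of its two positions, the pairs can be oriented so that
-- the set S* of first members meets every class with at least two elements.
-- The tuple is then determined by S*, the bijection σ : S* → S̄* sending each
-- position to its partner, and the values λ_i ∈ E_i ∩ E_σ(i) for i ∈ S*; such
-- triples are counted by Σ per M(S*).

module Submission where

open import Defs
open import Algebra.Bundles using (CommutativeSemigroup)
import Algebra.Properties.CommutativeSemigroup as CommutativeSemigroupProperties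
open import Data.Bool using (Bool; true; false; _xor_; if_then_else_)
open import Data.Bool.Properties using (xor-assoc; xor-comm; xor-same; xor-identityˡ; xor-identityʳ)
open import Data.Fin using (Fin; _≟_)
import Data.Fin as Fin
open import Data.Fin.Properties using (any?) renaming (suc-injective to Fin-suc-injective)
open import Data.Fin.Subset using (Subset; inside; outside; ∣_∣; _∪_; _∩_; ⁅_⁆; ∁)
  renaming (_∈_ to _∈ₛ_; _∉_ to _∉ₛ_; ⊥ to ∅)
open import Data.Fin.Subset.Properties
  using (_∈?_; x∈p∪q⁺; x∈p∪q⁻; x∈p∩q⁺; x∈⁅x⁆; x∈⁅y⁆⇒x≡y; ∉⊥; ∪-identityʳ; ∣⊥∣≡0; x∉p⇒x∈∁p)
import Data.List as List
open import Data.List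
  using (List; []; _∷_; _++_; map; concatMap; filter; length; allFin; zipWith; foldr; tabulate)
open import Data.List.Properties
  using (length-++; length-map; length-tabulate; map-cong; map-zipWith; zipWith-cong; map-tabulate; ∷-injective)
open import Data.List.Membership.Propositional using (_∈_; _∉_; find; lose)
open import Data.List.Membership.Propositional.Properties
  using (∈-map⁺; ∈-map⁻; ∈-concat⁺′; ∈-concatMap⁻; ∈-filter⁺; ∈-filter⁻; ∈-allFin; ∈-∃++)
open import Data.List.Relation.Binary.Disjoint.Propositional using (Disjoint)
open import Data.List.Relation.Binary.Permutation.Propositional as ↭ using (_↭_; ↭-sym; ↭⇒↭ₛ)
open import Data.List.Relation.Binary.Permutation.Propositional.Properties
  using (∈-resp-↭; ↭-length; shift)
import Data.List.Relation.Binary.Permutation.Setoid.Properties as SetoidPermutation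
open import Data.List.Relation.Binary.Pointwise using (Pointwise; []; _∷_)
open import Data.List.Relation.Binary.Subset.Propositional using (_⊆_)
open import Data.List.Relation.Unary.All using (All; []; _∷_)
open import Data.List.Relation.Unary.All.Properties using (All¬⇒¬Any)
import Data.List.Relation.Unary.All as All
open import Data.List.Relation.Unary.AllPairs using ([]; _∷_)
open import Data.List.Relation.Unary.Any using (Any; here; there)
import Data.List.Relation.Unary.Any as Any
open import Data.List.Relation.Unary.Unique.Propositional using (Unique)
open import Data.List.Relation.Unary.Unique.Propositional.Properties
  using (++⁺; map⁺; filter⁺; allFin⁺)
import Data.List.Relation.Unary.Unique.DecPropositional as UniqueDec
open import Data.Nat using (ℕ; zero; suc; _+_; _*_; _≤_; z≤n; s≤s)
open import Data.Nat.ListAction using (sum; product)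
open import Data.Nat.Properties
  using (≤-refl; ≤-trans; ≤-reflexive; +-mono-≤; n≤1+n; +-suc; suc-injective; +-commutativeSemigroup;
         module ≤-Reasoning)
open import Data.Product using (Σ; ∃; ∃₂; _×_; _,_; proj₁; proj₂)
open import Data.Sum using (_⊎_; inj₁; inj₂)
open import Data.Vec using (Vec; lookup; toList)
import Data.Vec as Vec
open import Data.Vec.Properties
  using (zipWith-assoc; zipWith-comm; zipWith-identityˡ; zipWith-identityʳ; ∷-injectiveˡ; ∷-injectiveʳ;
         []=⇒lookup; lookup∘tabulate; tabulate∘lookup; tabulate-cong; toList∘fromList)
import Data.Vec.Relation.Unary.All as VecAll
open import Data.Vec.Relation.Unary.All.Properties using (fromList⁺)
open import Function using (_∘_; id)
open import Function.Definitions using (Injective)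
open import Level using (0ℓ)
open import Relation.Binary.PropositionalEquality
  using (_≡_; _≢_; _≗_; refl; sym; trans; cong; cong₂; subst; setoid; module ≡-Reasoning)
open import Relation.Binary.PropositionalEquality.Algebra using (isMagma)
open import Relation.Nullary using (¬_; yes; no; _×-dec_; contradiction)
open import Relation.Nullary.Decidable using (does)

private
  variable
    A B : Set

∈⇒↭∷ : ∀ {x : A} {xs} → x ∈ xs → ∃ λ ys → xs ↭ x ∷ ys
∈⇒↭∷ x∈ with ∈-∃++ x∈
... | ys , zs , refl = ys ++ zs , shift _ ys zs

Unique-resp-↭ : ∀ {xs ys : List A} → xs ↭ ys → Unique xs → Unique ys
Unique-resp-↭ {A} xs↭ys = SetoidPermutation.Unique-resp-↭ (setoid A) (↭⇒↭ₛ xs↭ys)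

Unique-map-injectiveOn : ∀ (f : A → B) {xs} → Unique xs →
  (∀ {x y} → x ∈ xs → y ∈ xs → f x ≡ f y → x ≡ y) → Unique (map f xs)
Unique-map-injectiveOn f [] _ = []
Unique-map-injectiveOn f (x∉ ∷ u) f-inj =
  All.tabulate (λ y∈ fx≡fy → let y , y∈xs , e = ∈-map⁻ f y∈ in
                 All.lookup x∉ y∈xs (f-inj (here refl) (there y∈xs) (trans fx≡fy e)))
  ∷ Unique-map-injectiveOn f u (λ x∈ y∈ → f-inj (there x∈) (there y∈))

map≡map⇒≡ : ∀ {f g : A → B} {xs x} → map f xs ≡ map g xs → x ∈ xs → f x ≡ g x
map≡map⇒≡ e (here refl) = proj₁ (∷-injective e)
map≡map⇒≡ e (there x∈) = map≡map⇒≡ (proj₂ (∷-injective e)) x∈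

injection⇒length≤ : ∀ {xs : List A} {ys : List B} → Unique xs →
  (g : ∀ {x} → x ∈ xs → B) → (∀ {x} (x∈ : x ∈ xs) → g x∈ ∈ ys) →
  (∀ {x y} (x∈ : x ∈ xs) (y∈ : y ∈ xs) → g x∈ ≡ g y∈ → x ≡ y) →
  length xs ≤ length ys
injection⇒length≤ {xs = []} _ _ _ _ = z≤n
injection⇒length≤ {xs = x ∷ xs} {ys} (x∉ ∷ u) g g∈ g-inj with ∈⇒↭∷ (g∈ (here refl))
... | zs , ys↭ = begin
  suc (length xs) ≤⟨ s≤s (injection⇒length≤ u (λ y∈ → g (there y∈)) g∈zs
                             (λ y∈ z∈ → g-inj (there y∈) (there z∈))) ⟩
  suc (length zs) ≡⟨ ↭-length ys↭ ⟨
  length ys       ∎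
  where
  open ≤-Reasoning
  g∈zs : ∀ {y} (y∈ : y ∈ xs) → g (there y∈) ∈ zs
  g∈zs y∈ with ∈-resp-↭ ys↭ (g∈ (there y∈))
  ... | here e = contradiction (sym (g-inj (there y∈) (here refl) e)) (All.lookup x∉ y∈)
  ... | there g∈zs = g∈zs

length-concatMap : (f : A → List B) (xs : List A) →
                   length (concatMap f xs) ≡ sum (map (length ∘ f) xs)
length-concatMap f [] = refl
length-concatMap f (x ∷ xs) =
  trans (length-++ (f x)) (cong (length (f x) +_) (length-concatMap f xs))

choices : List (List A) → List (List A)
choices [] = [] ∷ []
choices (xs ∷ xss) = concatMap (λ x → map (x ∷_) (choices xss)) xs

length-choices : (xss : List (List A)) → length (choices xss) ≡ product (map length xss)
length-choices [] = refl
length-choices (xs ∷ xss) = go xs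
  where
  go : ∀ ys → length (concatMap (λ y → map (y ∷_) (choices xss)) ys)
              ≡ length ys * product (map length xss)
  go [] = refl
  go (y ∷ ys) =
    trans (length-++ (map (y ∷_) (choices xss)))
          (cong₂ _+_ (trans (length-map (List._∷_ y) (choices xss)) (length-choices xss)) (go ys))

∈-choices : ∀ {ws : List A} {xss} → Pointwise _∈_ ws xss → ws ∈ choices xss
∈-choices [] = here refl
∈-choices {ws = w ∷ ws} {xs ∷ xss} (w∈ ∷ ws∈) =
  ∈-concat⁺′ (∈-map⁺ (w ∷_) (∈-choices ws∈))
             (∈-map⁺ (λ x → map (x ∷_) (choices xss)) w∈)

Pointwise-map-zipWith : ∀ {C : Set} (h : A → B) (f : A → C) (G : A → C → List B) xs →
  (∀ {x} → x ∈ xs → h x ∈ G x (f x)) → Pointwise _∈_ (map h xs) (zipWith G xs (map f xs))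
Pointwise-map-zipWith h f G [] _ = []
Pointwise-map-zipWith h f G (x ∷ xs) h∈ =
  h∈ (here refl) ∷ Pointwise-map-zipWith h f G xs (h∈ ∘ there)

Unique-vecsOver : ∀ {xs : List A} → Unique xs → ∀ k → Unique (vecsOver xs k)
Unique-vecsOver _ zero = [] ∷ []
Unique-vecsOver {A} {xs} u (suc k) = go u
  where
  rows : A → List (Vec A (suc k))
  rows y = map (y Vec.∷_) (vecsOver xs k)
  disjoint : ∀ {y ys} → All (y ≢_) ys → Disjoint (rows y) (concatMap rows ys)
  disjoint {y} {ys} y∉ (v∈ , v∈′)
    with ∈-map⁻ (y Vec.∷_) v∈ | find (∈-concatMap⁻ rows {xs = ys} v∈′)
  ... | _ , _ , refl | z , z∈ , v∈z with ∈-map⁻ (z Vec.∷_) v∈z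
  ... | _ , _ , e = All.lookup y∉ z∈ (∷-injectiveˡ e)
  go : ∀ {ys} → Unique ys → Unique (concatMap rows ys)
  go [] = []
  go (y∉ ∷ u′) = ++⁺ (map⁺ ∷-injectiveʳ (Unique-vecsOver u k)) (go u′) (disjoint y∉)

∈-vecsOver : ∀ {xs : List A} {k} {v : Vec A k} → VecAll.All (_∈ xs) v → v ∈ vecsOver xs k
∈-vecsOver VecAll.[] = here refl
∈-vecsOver {xs = xs} (x∈ VecAll.∷ v∈) =
  ∈-concat⁺′ (∈-map⁺ _ (∈-vecsOver v∈))
             (∈-map⁺ (λ x → map (x Vec.∷_) (vecsOver xs _)) x∈)

∈-listsOver : ∀ {xs ys : List A} → All (_∈ xs) ys → ys ∈ listsOver xs (length ys)
∈-listsOver {xs = xs} {ys} ys∈ =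
  subst (_∈ listsOver xs (length ys)) (toList∘fromList ys)
        (∈-map⁺ toList (∈-vecsOver (fromList⁺ ys∈)))

∈-elems⁺ : ∀ {N} {S : Subset N} {i} → i ∈ₛ S → i ∈ elems S
∈-elems⁺ {S = S} {i} i∈ = ∈-filter⁺ (_∈? S) (∈-allFin i) i∈

∈-elems⁻ : ∀ {N} {S : Subset N} {i} → i ∈ elems S → i ∈ₛ S
∈-elems⁻ {N} {S} i∈ = proj₂ (∈-filter⁻ (_∈? S) {xs = allFin N} i∈)

Unique-elems : ∀ {N} (S : Subset N) → Unique (elems S)
Unique-elems {N} S = filter⁺ (_∈? S) (allFin⁺ N)

length-filter-∈?-suc : ∀ {N} b (S : Subset N) xs →
  length (filter (_∈? (b Vec.∷ S)) (map Fin.suc xs)) ≡ length (filter (_∈? S) xs)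
length-filter-∈?-suc b S [] = refl
length-filter-∈?-suc b S (x ∷ xs) with does (x ∈? S)
... | true  = cong suc (length-filter-∈?-suc b S xs)
... | false = length-filter-∈?-suc b S xs

length-filter-∈?-tabulate-suc : ∀ {N} b (S : Subset N) →
  length (filter (_∈? (b Vec.∷ S)) (tabulate Fin.suc)) ≡ length (elems S)
length-filter-∈?-tabulate-suc {N} b S =
  trans (cong (length ∘ filter (_∈? (b Vec.∷ S))) (sym (map-tabulate id Fin.suc)))
          (length-filter-∈?-suc b S (allFin N))

length-elems : ∀ {N} (S : Subset N) → length (elems S) ≡ ∣ S ∣
length-elems {zero} Vec.[] = refl
length-elems {suc N} (inside Vec.∷ S) =
  cong suc (trans (length-filter-∈?-tabulate-suc inside S) (length-elems S))
length-elems {suc N} (outside Vec.∷ S) =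
  trans (length-filter-∈?-tabulate-suc outside S) (length-elems S)

∣p∪⁅x⁆∣≡1+∣p∣ : ∀ {N} (P : Subset N) {x} → x ∉ₛ P → ∣ P ∪ ⁅ x ⁆ ∣ ≡ suc ∣ P ∣
∣p∪⁅x⁆∣≡1+∣p∣ (inside  Vec.∷ P) {Fin.zero}  x∉ = contradiction Vec.here x∉
∣p∪⁅x⁆∣≡1+∣p∣ (outside Vec.∷ P) {Fin.zero}  x∉ = cong (suc ∘ ∣_∣) (∪-identityʳ P)
∣p∪⁅x⁆∣≡1+∣p∣ (inside  Vec.∷ P) {Fin.suc x} x∉ = cong suc (∣p∪⁅x⁆∣≡1+∣p∣ P (x∉ ∘ Vec.there))
∣p∪⁅x⁆∣≡1+∣p∣ (outside Vec.∷ P) {Fin.suc x} x∉ = ∣p∪⁅x⁆∣≡1+∣p∣ P (x∉ ∘ Vec.there)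

member : ∀ {N} (P : Subset N) → 1 ≤ ∣ P ∣ → ∃ λ u → u ∈ₛ P
member (inside Vec.∷ P) _ = Fin.zero , Vec.here
member (outside Vec.∷ P) 1≤ with member P 1≤
... | u , u∈ = Fin.suc u , Vec.there u∈

two-members : ∀ {N} (P : Subset N) → 2 ≤ ∣ P ∣ → ∃₂ λ u v → u ≢ v × u ∈ₛ P × v ∈ₛ P
two-members (inside Vec.∷ P) (s≤s 1≤) with member P 1≤
... | v , v∈ = Fin.zero , Fin.suc v , (λ ()) , Vec.here , Vec.there v∈
two-members (outside Vec.∷ P) 2≤ with two-members P 2≤
... | u , v , u≢v , u∈ , v∈ =
  Fin.suc u , Fin.suc v , u≢v ∘ Fin-suc-injective , Vec.there u∈ , Vec.there v∈

∈-Class⁻ : ∀ {N r} (c : Fin N → Fin r) {a u} → u ∈ₛ Class c a → c u ≡ a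
∈-Class⁻ c {a} {u} u∈
  with c u ≟ a | trans (sym ([]=⇒lookup u∈)) (lookup∘tabulate (λ i → does (c i ≟ a)) u)
... | yes cu≡a | _ = cu≡a
... | no _     | ()

m+m≡n+n⇒m≡n : ∀ {m n} → m + m ≡ n + n → m ≡ n
m+m≡n+n⇒m≡n {zero}  {zero}  _ = refl
m+m≡n+n⇒m≡n {suc m} {suc n} e =
  cong suc (m+m≡n+n⇒m≡n (suc-injective (trans (sym (+-suc m m))
                                              (trans (suc-injective e) (+-suc n n)))))

⊕-assoc : ∀ {n} (u v w : F₂^ n) → (u ⊕ v) ⊕ w ≡ u ⊕ (v ⊕ w)
⊕-assoc = zipWith-assoc xor-assoc

⊕-comm : ∀ {n} (u v : F₂^ n) → u ⊕ v ≡ v ⊕ u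
⊕-comm = zipWith-comm xor-comm

⊕-identityˡ : ∀ {n} (u : F₂^ n) → 0v ⊕ u ≡ u
⊕-identityˡ = zipWith-identityˡ xor-identityˡ

⊕-identityʳ : ∀ {n} (u : F₂^ n) → u ⊕ 0v ≡ u
⊕-identityʳ = zipWith-identityʳ xor-identityʳ

⊕-self : ∀ {n} (u : F₂^ n) → u ⊕ u ≡ 0v
⊕-self Vec.[] = refl
⊕-self (b Vec.∷ u) = cong₂ Vec._∷_ (xor-same b) (⊕-self u)

⊕-commutativeSemigroup : ℕ → CommutativeSemigroup 0ℓ 0ℓ
⊕-commutativeSemigroup n = record
  { Carrier = F₂^ n ; _≈_ = _≡_ ; _∙_ = _⊕_
  ; isCommutativeSemigroup = record
    { isSemigroup = record { isMagma = isMagma _⊕_ ; assoc = ⊕-assoc }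
    ; comm = ⊕-comm } }

⊕-sum : ∀ {n} → (A → F₂^ n) → List A → F₂^ n
⊕-sum f = foldr (λ i acc → f i ⊕ acc) 0v

⊕-sum-cong : ∀ {n} {f g : A → F₂^ n} → f ≗ g → ∀ xs → ⊕-sum f xs ≡ ⊕-sum g xs
⊕-sum-cong f≗g [] = refl
⊕-sum-cong f≗g (x ∷ xs) = cong₂ _⊕_ (f≗g x) (⊕-sum-cong f≗g xs)

⊕-sum-0 : ∀ {n} (xs : List A) → ⊕-sum (λ _ → 0v {n}) xs ≡ 0v
⊕-sum-0 [] = refl
⊕-sum-0 (_ ∷ xs) = trans (⊕-identityˡ _) (⊕-sum-0 xs)

⊕-sum-⊕ : ∀ {n} (f g : A → F₂^ n) xs →
          ⊕-sum (λ i → f i ⊕ g i) xs ≡ ⊕-sum f xs ⊕ ⊕-sum g xs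
⊕-sum-⊕ f g [] = sym (⊕-identityˡ 0v)
⊕-sum-⊕ {n = n} f g (x ∷ xs) =
  trans (cong (f x ⊕ g x ⊕_) (⊕-sum-⊕ f g xs))
        (CommutativeSemigroupProperties.interchange (⊕-commutativeSemigroup n) (f x) (g x) _ _)

-- Multiplicities mod 2

sign : Bool → Sign
sign true  = 1ₛ
sign false = 0ₛ

sign-xor-· : ∀ {n} a b (u : F₂^ n) → sign (a xor b) · u ≡ sign a · u ⊕ sign b · u
sign-xor-· false b     u = sym (⊕-identityˡ _)
sign-xor-· true  false u = sym (⊕-identityʳ u)
sign-xor-· true  true  u = sym (⊕-self u)

∣sign-xor∣≤ : ∀ a b → absₛ (sign (a xor b)) ≤ absₛ (sign a) + absₛ (sign b)
∣sign-xor∣≤ false b     = ≤-refl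
∣sign-xor∣≤ true  false = ≤-refl
∣sign-xor∣≤ true  true  = z≤n

xor-swap : ∀ a b c → a xor (b xor c) ≡ b xor (a xor c)
xor-swap false b c = refl
xor-swap true false c = refl
xor-swap true true c = refl

sum-map-≤-+ : ∀ (f g h : A → ℕ) → (∀ x → f x ≤ g x + h x) → ∀ xs →
  sum (map f xs) ≤ sum (map g xs) + sum (map h xs)
sum-map-≤-+ f g h f≤ [] = z≤n
sum-map-≤-+ f g h f≤ (x ∷ xs) =
  ≤-trans (+-mono-≤ (f≤ x) (sum-map-≤-+ f g h f≤ xs))
          (≤-reflexive (CommutativeSemigroupProperties.interchange +-commutativeSemigroup
                                                                      (g x) (h x) _ _))

module _ {m : ℕ} where

  δ : Fin m → Fin m → Bool
  δ x v = does (x ≟ v)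

  ⊕-sum-δ-∉ : ∀ {n} (g : Fin m → F₂^ n) {x} xs → x ∉ xs →
              ⊕-sum (λ v → sign (δ x v) · g v) xs ≡ 0v
  ⊕-sum-δ-∉ g [] _ = refl
  ⊕-sum-δ-∉ g {x} (y ∷ xs) x∉ with x ≟ y
  ... | yes x≡y = contradiction (here x≡y) x∉
  ... | no _    = trans (⊕-identityˡ _) (⊕-sum-δ-∉ g xs (x∉ ∘ there))

  ⊕-sum-δ : ∀ {n} (g : Fin m → F₂^ n) {x xs} → Unique xs → x ∈ xs →
            ⊕-sum (λ v → sign (δ x v) · g v) xs ≡ g x
  ⊕-sum-δ g {x} {y ∷ xs} (y∉ ∷ u) x∈ with x ≟ y | x∈
  ... | yes refl | _ =
    trans (cong (g x ⊕_) (⊕-sum-δ-∉ g xs (λ x∈xs → All.lookup y∉ x∈xs refl))) (⊕-identityʳ _)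
  ... | no x≢y | here x≡y = contradiction x≡y x≢y
  ... | no _   | there x∈xs = trans (⊕-identityˡ _) (⊕-sum-δ g u x∈xs)

  count-δ-∉ : ∀ {x} xs → x ∉ xs → sum (map (λ v → absₛ (sign (δ x v))) xs) ≡ 0
  count-δ-∉ [] _ = refl
  count-δ-∉ {x} (y ∷ xs) x∉ with x ≟ y
  ... | yes x≡y = contradiction (here x≡y) x∉
  ... | no _    = count-δ-∉ xs (x∉ ∘ there)

  count-δ : ∀ {x xs} → Unique xs → sum (map (λ v → absₛ (sign (δ x v))) xs) ≤ 1
  count-δ [] = z≤n
  count-δ {x} {y ∷ xs} (y∉ ∷ u) with x ≟ y
  ... | yes refl = ≤-reflexive (cong suc (count-δ-∉ xs (λ x∈xs → All.lookup y∉ x∈xs refl)))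
  ... | no _     = count-δ {x} u

module _ {N m : ℕ} (t : Fin N → Fin m) where

  parity : Fin m → List (Fin N) → Bool
  parity v [] = false
  parity v (i ∷ L) = δ (t i) v xor parity v L

  parity-resp-↭ : ∀ {v L L′} → L ↭ L′ → parity v L ≡ parity v L′
  parity-resp-↭ ↭.refl = refl
  parity-resp-↭ {v} (↭.prep x L↭) = cong (δ (t x) v xor_) (parity-resp-↭ L↭)
  parity-resp-↭ {v} (↭.swap x y L↭) =
    trans (xor-swap (δ (t x) v) (δ (t y) v) _)
          (cong (λ b → δ (t y) v xor (δ (t x) v xor b)) (parity-resp-↭ L↭))
  parity-resp-↭ (↭.trans L↭ L↭′) = trans (parity-resp-↭ L↭) (parity-resp-↭ L↭′)

  parity-drop-pair : ∀ {v x y L} → t x ≡ t y → parity v (x ∷ y ∷ L) ≡ parity v L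
  parity-drop-pair {v} {x} {y} {L} tx≡ty rewrite tx≡ty =
    trans (sym (xor-assoc (δ (t y) v) (δ (t y) v) (parity v L)))
          (cong (_xor parity v L) (xor-same (δ (t y) v)))

  parity≡true⇒∈ : ∀ {v} L → parity v L ≡ true → ∃ λ i → i ∈ L × t i ≡ v
  parity≡true⇒∈ {v} (i ∷ L) odd with t i ≟ v
  ... | yes ti≡v = i , here refl , ti≡v
  ... | no _ with parity≡true⇒∈ L odd
  ...   | j , j∈ , tj≡v = j , there j∈ , tj≡v

  parity-head : ∀ {x L} → parity (t x) (x ∷ L) ≡ false → parity (t x) L ≡ true
  parity-head {x} {L} even with t x ≟ t x | parity (t x) L
  ... | yes _   | true  = refl
  ... | yes _   | false = contradiction even λ ()
  ... | no tx≢tx | _    = contradiction refl tx≢tx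

  module _ {n : ℕ} (λv : Fin m → F₂^ n) where

    ⊕-sum-parity : ∀ L → ⊕-sum (λ v → sign (parity v L) · λv v) (allFin m)
                         ≡ ⊕-sum (λv ∘ t) L
    ⊕-sum-parity [] = ⊕-sum-0 (allFin m)
    ⊕-sum-parity (x ∷ L) = begin
      ⊕-sum (λ v → sign (δ (t x) v xor parity v L) · λv v) (allFin m)
        ≡⟨ ⊕-sum-cong (λ v → sign-xor-· (δ (t x) v) (parity v L) (λv v)) (allFin m) ⟩
      ⊕-sum (λ v → sign (δ (t x) v) · λv v ⊕ sign (parity v L) · λv v) (allFin m)
        ≡⟨ ⊕-sum-⊕ _ _ (allFin m) ⟩
      ⊕-sum (λ v → sign (δ (t x) v) · λv v) (allFin m)
        ⊕ ⊕-sum (λ v → sign (parity v L) · λv v) (allFin m)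
        ≡⟨ cong₂ _⊕_ (⊕-sum-δ λv (allFin⁺ m) (∈-allFin (t x))) (⊕-sum-parity L) ⟩
      λv (t x) ⊕ ⊕-sum (λv ∘ t) L ∎
      where open ≡-Reasoning

  count-parity : ∀ L → sum (map (λ v → absₛ (sign (parity v L))) (allFin m)) ≤ length L
  count-parity [] = ≤-reflexive (sum-zeros (allFin m))
    where
    sum-zeros : ∀ (vs : List (Fin m)) → sum (map (λ _ → 0) vs) ≡ 0
    sum-zeros [] = refl
    sum-zeros (_ ∷ vs) = sum-zeros vs
  count-parity (x ∷ L) =
    ≤-trans (sum-map-≤-+ _ _ _ (λ v → ∣sign-xor∣≤ (δ (t x) v) (parity v L)) (allFin m))
            (+-mono-≤ (count-δ {x = t x} (allFin⁺ m)) (count-parity L))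

evenness : ∀ {n m N} (λv : Fin m → F₂^ n) → InΛ N λv → (t : Fin N → Fin m) →
           Σv (λv ∘ t) ≡ 0v → ∀ v → parity t v (allFin N) ≡ false
evenness {m = m} {N} λv inΛ t Σ≡0 v with parity t v (allFin N) in odd
... | false = refl
... | true  = contradiction (trans (cong sign (sym odd)) (inΛ ε ε-short ε-vanishes v)) λ ()
  where
  ε : Fin m → Sign
  ε w = sign (parity t w (allFin N))
  ε-short : Σℕ (λ w → absₛ (ε w)) ≤ N
  ε-short = ≤-trans (count-parity t (allFin N)) (≤-reflexive (length-tabulate id))
  ε-vanishes : Σv (λ w → ε w · λv w) ≡ 0v
  ε-vanishes = trans (⊕-sum-parity t λv (allFin N)) Σ≡0

-- Orienting pairs so as to meet every class

MeetsClasses : ∀ {N r} → (Fin N → Fin r) → List (Fin N) → Subset N → Set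
MeetsClasses c L S =
  ∀ {u v} → u ∈ L → v ∈ L → u ≢ v → c u ≡ c v → ∃ λ i → i ∈ₛ S × c i ≡ c u

MeetsClasses-antitone : ∀ {N r} {c : Fin N → Fin r} {L L′ S} →
                        L′ ⊆ L → MeetsClasses c L S → MeetsClasses c L′ S
MeetsClasses-antitone L′⊆L meets u∈ v∈ = meets (L′⊆L u∈) (L′⊆L v∈)

merge : ∀ {N r} → (Fin N → Fin r) → Fin r → Fin r → Fin N → Fin r
merge c a b z = if does (c z ≟ b) then a else c z

module MergeProperties {N r} (c : Fin N → Fin r) (a b : Fin r) where

  merge-≡ : ∀ {z} → c z ≡ b → merge c a b z ≡ a
  merge-≡ {z} cz≡b with c z ≟ b
  ... | yes _    = refl
  ... | no cz≢b = contradiction cz≡b cz≢b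

  merge-≢ : ∀ {z} → c z ≢ b → merge c a b z ≡ c z
  merge-≢ {z} cz≢b with c z ≟ b
  ... | yes cz≡b = contradiction cz≡b cz≢b
  ... | no _     = refl

module Orientation {N r} (c : Fin N → Fin r) {x y : Fin N} {L′ : List (Fin N)} {S′ : Subset N}
                   (meets′ : MeetsClasses (merge c (c x) (c y)) L′ S′) where

  open MergeProperties c (c x) (c y)

  private
    L : List (Fin N)
    L = x ∷ y ∷ L′

  ∈L′ : ∀ {z} → z ∈ L → z ≢ x → z ≢ y → z ∈ L′
  ∈L′ (here z≡x) z≢x _ = contradiction z≡x z≢x
  ∈L′ (there (here z≡y)) _ z≢y = contradiction z≡y z≢y
  ∈L′ (there (there z∈)) _ _ = z∈

  another-member : ∀ {u v} → u ∈ L → v ∈ L → u ≢ v → c u ≡ c v → ∀ a →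
                   ∃ λ w → w ∈ L × w ≢ a × c w ≡ c u
  another-member {u} {v} u∈ v∈ u≢v cu≡cv a with u ≟ a
  ... | no u≢a   = u , u∈ , u≢a , refl
  ... | yes refl = v , v∈ , u≢v ∘ sym , sym cu≡cv

  meets-unmerged : ∀ {u v} → u ∈ L → v ∈ L → u ≢ v → c u ≡ c v → c u ≢ c x → c u ≢ c y →
                   ∃ λ i → i ∈ₛ S′ × c i ≡ c u
  meets-unmerged {u} {v} u∈ v∈ u≢v cu≡cv cu≢cx cu≢cy
    with meets′ (∈L′ u∈ (cu≢cx ∘ cong c) (cu≢cy ∘ cong c))
                (∈L′ v∈ (cv≢cx ∘ cong c) (cv≢cy ∘ cong c)) u≢v
                (trans (merge-≢ cu≢cy) (trans cu≡cv (sym (merge-≢ cv≢cy))))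
    where
    cv≢cx : c v ≢ c x
    cv≢cx = cu≢cx ∘ trans cu≡cv
    cv≢cy : c v ≢ c y
    cv≢cy = cu≢cy ∘ trans cu≡cv
  ... | i , i∈ , ci≡ with c i ≟ c y
  ...   | yes _ = contradiction (trans ci≡ (merge-≢ cu≢cy)) (cu≢cx ∘ sym)
  ...   | no _  = i , i∈ , trans ci≡ (merge-≢ cu≢cy)

  MeetsClassOfy : Set
  MeetsClassOfy = ∃ λ i → i ∈ₛ S′ × c i ≡ c y

  orient-x : MeetsClassOfy ⊎ ¬ Any (λ z → c z ≡ c y) L′ → MeetsClasses c L (S′ ∪ ⁅ x ⁆)
  orient-x hit-or-absent {u} {v} u∈ v∈ u≢v cu≡cv with c u ≟ c x | c u ≟ c y
  ... | yes cu≡cx | _ = x , x∈p∪q⁺ (inj₂ (x∈⁅x⁆ x)) , sym cu≡cx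
  ... | no cu≢cx | no cu≢cy with meets-unmerged u∈ v∈ u≢v cu≡cv cu≢cx cu≢cy
  ...   | i , i∈ , ci≡cu = i , x∈p∪q⁺ (inj₁ i∈) , ci≡cu
  orient-x (inj₁ (i , i∈ , ci≡cy)) _ _ _ _ | no _ | yes cu≡cy =
    i , x∈p∪q⁺ (inj₁ i∈) , trans ci≡cy (sym cu≡cy)
  orient-x (inj₂ absent) u∈ v∈ u≢v cu≡cv | no cu≢cx | yes cu≡cy
    with another-member u∈ v∈ u≢v cu≡cv y
  ... | w , w∈ , w≢y , cw≡cu =
    contradiction (lose (∈L′ w∈ (λ { refl → cu≢cx (sym cw≡cu) }) w≢y) (trans cw≡cu cu≡cy))
                  absent

  -- w and z are distinct members of the merged class of x and y.
  meets-class-of-x : ¬ MeetsClassOfy → ∀ {w z} → w ∈ L′ → z ∈ L′ → c w ≡ c x → c z ≡ c y →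
                     c x ≢ c y → ∃ λ i → i ∈ₛ S′ × c i ≡ c x
  meets-class-of-x miss {w} w∈ z∈ cw≡cx cz≡cy cx≢cy
    with meets′ z∈ w∈ (λ { refl → cx≢cy (trans (sym cw≡cx) cz≡cy) })
                (trans (merge-≡ cz≡cy) (sym (trans (merge-≢ cw≢cy) cw≡cx)))
    where
    cw≢cy : c w ≢ c y
    cw≢cy = cx≢cy ∘ trans (sym cw≡cx)
  ... | i , i∈ , ci≡ with c i ≟ c y
  ...   | yes ci≡cy = contradiction (i , i∈ , ci≡cy) miss
  ...   | no _      = i , i∈ , trans ci≡ (merge-≡ cz≡cy)

  orient-y : ¬ MeetsClassOfy → Any (λ z → c z ≡ c y) L′ → MeetsClasses c L (S′ ∪ ⁅ y ⁆)
  orient-y miss present {u} {v} u∈ v∈ u≢v cu≡cv with c u ≟ c y | c u ≟ c x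
  ... | yes cu≡cy | _ = y , x∈p∪q⁺ (inj₂ (x∈⁅x⁆ y)) , sym cu≡cy
  ... | no cu≢cy | no cu≢cx with meets-unmerged u∈ v∈ u≢v cu≡cv cu≢cx cu≢cy
  ...   | i , i∈ , ci≡cu = i , x∈p∪q⁺ (inj₁ i∈) , ci≡cu
  orient-y miss present u∈ v∈ u≢v cu≡cv | no cu≢cy | yes cu≡cx
    with another-member u∈ v∈ u≢v cu≡cv x | find present
  ... | w , w∈ , w≢x , cw≡cu | z , z∈ , cz≡cy
    with meets-class-of-x miss (∈L′ w∈ w≢x w≢y) z∈ (trans cw≡cu cu≡cx) cz≡cy cx≢cy
    where
    cx≢cy : c x ≢ c y
    cx≢cy = cu≢cy ∘ trans cu≡cx
    w≢y : w ≢ y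
    w≢y refl = cu≢cy (sym cw≡cu)
  ...   | i , i∈ , ci≡cx = i , x∈p∪q⁺ (inj₁ i∈) , trans ci≡cx (sym cu≡cx)

  orient : MeetsClasses c L (S′ ∪ ⁅ x ⁆) ⊎ MeetsClasses c L (S′ ∪ ⁅ y ⁆)
  orient with any? (λ i → (i ∈? S′) ×-dec (c i ≟ c y)) | Any.any? (λ z → c z ≟ c y) L′
  ... | yes hit  | _           = inj₁ (orient-x (inj₁ hit))
  ... | no miss  | yes present = inj₂ (orient-y miss present)
  ... | no _     | no absent   = inj₁ (orient-x (inj₂ absent))

-- Pairings of positions carrying equal values

record Pairing {N} (t : Fin N → A) (L : List (Fin N)) : Set where
  field
    S                 : Subset N
    partner           : Fin N → Fin N
    S⊆L               : ∀ {i} → i ∈ₛ S → i ∈ L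
    partner∈L         : ∀ {i} → i ∈ₛ S → partner i ∈ L
    partner∉S         : ∀ {i} → i ∈ₛ S → partner i ∉ₛ S
    t∘partner         : ∀ {i} → i ∈ₛ S → t (partner i) ≡ t i
    partner-injective : ∀ {i j} → i ∈ₛ S → j ∈ₛ S → partner i ≡ partner j → i ≡ j
    partner-onto      : ∀ {j} → j ∈ L → j ∉ₛ S → ∃ λ i → i ∈ₛ S × partner i ≡ j
    length≡∣S∣+∣S∣    : length L ≡ ∣ S ∣ + ∣ S ∣

open Pairing

emptyPairing : ∀ {N} {t : Fin N → A} → Pairing t []
emptyPairing {N = N} = record
  { S = ∅ ; partner = id
  ; S⊆L = λ i∈ → contradiction i∈ ∉⊥
  ; partner∈L = λ i∈ → contradiction i∈ ∉⊥
  ; partner∉S = λ i∈ → contradiction i∈ ∉⊥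
  ; t∘partner = λ i∈ → contradiction i∈ ∉⊥
  ; partner-injective = λ i∈ → contradiction i∈ ∉⊥
  ; partner-onto = λ ()
  ; length≡∣S∣+∣S∣ = sym (cong₂ _+_ (∣⊥∣≡0 N) (∣⊥∣≡0 N)) }

Pairing-resp-↭ : ∀ {N} {t : Fin N → A} {L L′} → L ↭ L′ → Pairing t L → Pairing t L′
Pairing-resp-↭ L↭L′ P = record
  { S = S P ; partner = partner P
  ; S⊆L = λ i∈ → ∈-resp-↭ L↭L′ (S⊆L P i∈)
  ; partner∈L = λ i∈ → ∈-resp-↭ L↭L′ (partner∈L P i∈)
  ; partner∉S = partner∉S P ; t∘partner = t∘partner P ; partner-injective = partner-injective P
  ; partner-onto = λ j∈ → partner-onto P (∈-resp-↭ (↭-sym L↭L′) j∈)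
  ; length≡∣S∣+∣S∣ = trans (sym (↭-length L↭L′)) (length≡∣S∣+∣S∣ P) }

module Extension {N} {t : Fin N → A} {s s̄ : Fin N} {L : List (Fin N)}
                 (s≢s̄ : s ≢ s̄) (s∉L : s ∉ L) (s̄∉L : s̄ ∉ L) (ts̄≡ts : t s̄ ≡ t s)
                 (P : Pairing t L) where

  S⁺ : Subset N
  S⁺ = S P ∪ ⁅ s ⁆

  partner⁺ : Fin N → Fin N
  partner⁺ z = if does (z ≟ s) then s̄ else partner P z

  partner⁺-s : partner⁺ s ≡ s̄
  partner⁺-s with s ≟ s
  ... | yes _   = refl
  ... | no s≢s = contradiction refl s≢s

  partner⁺-old : ∀ {z} → z ≢ s → partner⁺ z ≡ partner P z
  partner⁺-old {z} z≢s with z ≟ s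
  ... | yes z≡s = contradiction z≡s z≢s
  ... | no _    = refl

  s∈S⁺ : s ∈ₛ S⁺
  s∈S⁺ = x∈p∪q⁺ (inj₂ (x∈⁅x⁆ s))

  S⊆S⁺ : ∀ {i} → i ∈ₛ S P → i ∈ₛ S⁺
  S⊆S⁺ i∈ = x∈p∪q⁺ (inj₁ i∈)

  ∉S⁺ : ∀ {z} → z ∉ₛ S P → z ≢ s → z ∉ₛ S⁺
  ∉S⁺ z∉S z≢s z∈ with x∈p∪q⁻ (S P) ⁅ s ⁆ z∈
  ... | inj₁ z∈S = z∉S z∈S
  ... | inj₂ z∈⁅s⁆ = z≢s (x∈⁅y⁆⇒x≡y s z∈⁅s⁆)

  data InS⁺ : Fin N → Set where
    new : InS⁺ s
    old : ∀ {i} → i ∈ₛ S P → i ≢ s → InS⁺ i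

  inS⁺ : ∀ {i} → i ∈ₛ S⁺ → InS⁺ i
  inS⁺ i∈ with x∈p∪q⁻ (S P) ⁅ s ⁆ i∈
  ... | inj₁ i∈S = old i∈S λ { refl → s∉L (S⊆L P i∈S) }
  ... | inj₂ i∈⁅s⁆ rewrite x∈⁅y⁆⇒x≡y s i∈⁅s⁆ = new

  partner∈L⁺ : ∀ {i} → i ∈ₛ S⁺ → partner⁺ i ∈ s ∷ s̄ ∷ L
  partner∈L⁺ i∈ with inS⁺ i∈
  ... | new = there (here partner⁺-s)
  ... | old i∈S i≢s rewrite partner⁺-old i≢s = there (there (partner∈L P i∈S))

  partner∉S⁺ : ∀ {i} → i ∈ₛ S⁺ → partner⁺ i ∉ₛ S⁺
  partner∉S⁺ i∈ with inS⁺ i∈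
  ... | new rewrite partner⁺-s = ∉S⁺ (s̄∉L ∘ S⊆L P) (s≢s̄ ∘ sym)
  ... | old i∈S i≢s rewrite partner⁺-old i≢s =
    ∉S⁺ (partner∉S P i∈S) (λ p≡s → s∉L (subst (_∈ L) p≡s (partner∈L P i∈S)))

  S⁺⊆L⁺ : ∀ {i} → i ∈ₛ S⁺ → i ∈ s ∷ s̄ ∷ L
  S⁺⊆L⁺ i∈ with inS⁺ i∈
  ... | new = here refl
  ... | old i∈S _ = there (there (S⊆L P i∈S))

  t∘partner⁺ : ∀ {i} → i ∈ₛ S⁺ → t (partner⁺ i) ≡ t i
  t∘partner⁺ i∈ with inS⁺ i∈
  ... | new = trans (cong t partner⁺-s) ts̄≡ts
  ... | old i∈S i≢s = trans (cong t (partner⁺-old i≢s)) (t∘partner P i∈S)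

  partner-is-s̄ : ∀ {i} → i ∈ₛ S P → i ≢ s → partner⁺ i ≡ partner⁺ s → s̄ ∈ L
  partner-is-s̄ i∈S i≢s e =
    subst (_∈ L) (trans (sym (partner⁺-old i≢s)) (trans e partner⁺-s)) (partner∈L P i∈S)

  partner⁺-injective : ∀ {i j} → i ∈ₛ S⁺ → j ∈ₛ S⁺ → partner⁺ i ≡ partner⁺ j → i ≡ j
  partner⁺-injective i∈ j∈ e with inS⁺ i∈ | inS⁺ j∈
  ... | new | new = refl
  ... | new | old j∈S j≢s = contradiction (partner-is-s̄ j∈S j≢s (sym e)) s̄∉L
  ... | old i∈S i≢s | new = contradiction (partner-is-s̄ i∈S i≢s e) s̄∉L
  ... | old i∈S i≢s | old j∈S j≢s =
    partner-injective P i∈S j∈S (trans (sym (partner⁺-old i≢s)) (trans e (partner⁺-old j≢s)))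

  partner⁺-onto : ∀ {j} → j ∈ s ∷ s̄ ∷ L → j ∉ₛ S⁺ → ∃ λ i → i ∈ₛ S⁺ × partner⁺ i ≡ j
  partner⁺-onto (here refl) j∉ = contradiction s∈S⁺ j∉
  partner⁺-onto (there (here refl)) _ = s , s∈S⁺ , partner⁺-s
  partner⁺-onto (there (there j∈L)) j∉ with partner-onto P j∈L (j∉ ∘ S⊆S⁺)
  ... | i , i∈S , pi≡j =
    i , S⊆S⁺ i∈S , trans (partner⁺-old (λ { refl → s∉L (S⊆L P i∈S) })) pi≡j

  length≡∣S⁺∣+∣S⁺∣ : length (s ∷ s̄ ∷ L) ≡ ∣ S⁺ ∣ + ∣ S⁺ ∣
  length≡∣S⁺∣+∣S⁺∣ = begin
    suc (suc (length L))               ≡⟨ cong (suc ∘ suc) (length≡∣S∣+∣S∣ P) ⟩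
    suc (suc (∣ S P ∣ + ∣ S P ∣))      ≡⟨ cong suc (+-suc ∣ S P ∣ ∣ S P ∣) ⟨
    suc ∣ S P ∣ + suc ∣ S P ∣          ≡⟨ cong₂ _+_ ∣S⁺∣≡ ∣S⁺∣≡ ⟨
    ∣ S⁺ ∣ + ∣ S⁺ ∣                    ∎
    where
    open ≡-Reasoning
    ∣S⁺∣≡ : ∣ S⁺ ∣ ≡ suc ∣ S P ∣
    ∣S⁺∣≡ = ∣p∪⁅x⁆∣≡1+∣p∣ (S P) (s∉L ∘ S⊆L P)

  extended : Pairing t (s ∷ s̄ ∷ L)
  extended = record
    { S = S⁺ ; partner = partner⁺ ; S⊆L = S⁺⊆L⁺ ; partner∈L = partner∈L⁺
    ; partner∉S = partner∉S⁺ ; t∘partner = t∘partner⁺ ; partner-injective = partner⁺-injective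
    ; partner-onto = partner⁺-onto ; length≡∣S∣+∣S∣ = length≡∣S⁺∣+∣S⁺∣ }

AdmissiblePairing : ∀ {N r} → (Fin N → A) → (Fin N → Fin r) → List (Fin N) → Set
AdmissiblePairing t c L = Σ (Pairing t L) λ P → MeetsClasses c L (S P)

AdmissiblePairing-resp-↭ : ∀ {N r} {t : Fin N → A} {c : Fin N → Fin r} {L L′} →
  L ↭ L′ → AdmissiblePairing t c L → AdmissiblePairing t c L′
AdmissiblePairing-resp-↭ L↭L′ (P , meets) =
  Pairing-resp-↭ L↭L′ P , MeetsClasses-antitone (∈-resp-↭ (↭-sym L↭L′)) meets

extendAdmissible : ∀ {N r} {t : Fin N → A} (c : Fin N → Fin r) {x y L} →
  Unique (x ∷ y ∷ L) → t y ≡ t x →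
  AdmissiblePairing t (merge c (c x) (c y)) L → AdmissiblePairing t c (x ∷ y ∷ L)
extendAdmissible c ((x≢y ∷ x≢L) ∷ y≢L ∷ _) ty≡tx (P , meets′) with Orientation.orient c meets′
... | inj₁ meets =
  Extension.extended x≢y (All¬⇒¬Any x≢L) (All¬⇒¬Any y≢L) ty≡tx P , meets
... | inj₂ meets =
  Pairing-resp-↭ (↭.swap _ _ ↭.refl)
    (Extension.extended (x≢y ∘ sym) (All¬⇒¬Any y≢L) (All¬⇒¬Any x≢L) (sym ty≡tx) P) , meets

admissiblePairing : ∀ {N m r} (t : Fin N → Fin m) (c : Fin N → Fin r) L →
  Unique L → (∀ v → parity t v L ≡ false) → AdmissiblePairing t c L
admissiblePairing t c L = go (length L) c L ≤-refl
  where
  go : ∀ k c L → length L ≤ k → Unique L → (∀ v → parity t v L ≡ false) →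
       AdmissiblePairing t c L
  go _ c [] _ _ _ = emptyPairing , λ ()
  go (suc k) c (x ∷ L₀) (s≤s ∣L₀∣≤k) u even
    with parity≡true⇒∈ t L₀ (parity-head t {L = L₀} (even (t x)))
  ... | y , y∈L₀ , ty≡tx with ∈⇒↭∷ y∈L₀
  ... | L′ , L₀↭ =
    AdmissiblePairing-resp-↭ (↭-sym perm)
      (extendAdmissible c u′ ty≡tx (go k (merge c (c x) (c y)) L′ ∣L′∣≤k u″ even′))
    where
    perm : x ∷ L₀ ↭ x ∷ y ∷ L′
    perm = ↭.prep x L₀↭
    u′ : Unique (x ∷ y ∷ L′)
    u′ = Unique-resp-↭ perm u
    u″ : Unique L′
    u″ with u′
    ... | _ ∷ _ ∷ u″ = u″
    ∣L′∣≤k : length L′ ≤ k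
    ∣L′∣≤k = ≤-trans (n≤1+n _) (subst (_≤ k) (↭-length L₀↭) ∣L₀∣≤k)
    even′ : ∀ v → parity t v L′ ≡ false
    even′ v = trans (sym (parity-drop-pair t {L = L′} (sym ty≡tx)))
                    (trans (sym (parity-resp-↭ t perm)) (even v))

pairing-determines : ∀ {N} {t t′ : Fin N → A} {L} (P : Pairing t L) (P′ : Pairing t′ L) →
  S P ≡ S P′ → (∀ {i} → i ∈ₛ S P → partner P i ≡ partner P′ i) →
  (∀ {i} → i ∈ₛ S P → t i ≡ t′ i) → ∀ {j} → j ∈ L → t j ≡ t′ j
pairing-determines {t = t} {t′} P P′ S≡S′ partner≡ t≡ {j} j∈ with j ∈? S P
... | yes j∈S = t≡ j∈S
... | no j∉S with partner-onto P j∈ j∉S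
...   | i , i∈S , pi≡j = begin
  t j               ≡⟨ cong t pi≡j ⟨
  t (partner P i)   ≡⟨ t∘partner P i∈S ⟩
  t i               ≡⟨ t≡ i∈S ⟩
  t′ i              ≡⟨ t∘partner P′ (subst (i ∈ₛ_) S≡S′ i∈S) ⟨
  t′ (partner P′ i) ≡⟨ cong t′ (trans (sym (partner≡ i∈S)) pi≡j) ⟩
  t′ j              ∎
  where open ≡-Reasoning

-- Counting

-- A set S*, a bijection σ : S* → S̄* listed as its values along elems S*, and
-- the indices of the values λ_i ∈ E_i ∩ E_σ(i) for i ∈ S*.
Witness : ℕ → ℕ → Set
Witness N m = Subset N × List (Fin N) × List (Fin m)

bijections : ∀ {N} → Subset N → List (List (Fin N))
bijections S = filter (UniqueDec.unique? _≟_) (listsOver (elems (∁ S)) (length (elems S)))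

common : ∀ {N m} → (Fin N → Subset m) → Fin N → Fin N → List (Fin m)
common E i j = elems (E i ∩ E j)

witnessesAt : ∀ {N m} → (Fin N → Subset m) → Subset N → List (Witness N m)
witnessesAt E S =
  concatMap (λ σ → map (λ w → S , σ , w) (choices (zipWith (common E) (elems S) σ))) (bijections S)

witnesses : ∀ {m r} p → (Fin (p + p) → Subset m) → (Fin (p + p) → Fin r) →
            List (Witness (p + p) m)
witnesses p E c = concatMap (witnessesAt E) (goodSubsets p c)

length-witnessesAt : ∀ {N m} (E : Fin N → Subset m) S →
  length (witnessesAt E S) ≡ per (elems S) (elems (∁ S)) (λ i j → ∣ E i ∩ E j ∣)
length-witnessesAt {m = m} E S =
  trans (length-concatMap _ (bijections S)) (cong sum (map-cong length-at (bijections S)))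
  where
  length-at : ∀ σ → length (map (λ w → S , σ , w) (choices (zipWith (common E) (elems S) σ)))
                    ≡ product (zipWith (λ i j → ∣ E i ∩ E j ∣) (elems S) σ)
  length-at σ = begin
    length (map _ (choices entries)) ≡⟨ length-map (λ w → S , σ , w) (choices entries) ⟩
    length (choices entries)         ≡⟨ length-choices entries ⟩
    product (map length entries)     ≡⟨ cong product (map-zipWith (common E) length (elems S) σ) ⟩
    product (zipWith (λ i j → length (common E i j)) (elems S) σ)
      ≡⟨ cong product (zipWith-cong (λ i j → length-elems (E i ∩ E j)) (elems S) σ) ⟩
    product (zipWith (λ i j → ∣ E i ∩ E j ∣) (elems S) σ) ∎
    where
    open ≡-Reasoning
    entries : List (List (Fin m))
    entries = zipWith (common E) (elems S) σ

length-witnesses : ∀ {m r} p (E : Fin (p + p) → Subset m) (c : Fin (p + p) → Fin r) →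
  length (witnesses p E c) ≡ RHS p E c
length-witnesses p E c =
  trans (length-concatMap (witnessesAt E) (goodSubsets p c))
        (cong sum (map-cong (length-witnessesAt E) (goodSubsets p c)))

module _ {N} {t : Fin N → A} {L} (P : Pairing t L) where

  partners∈bijections : map (partner P) (elems (S P)) ∈ bijections (S P)
  partners∈bijections = ∈-filter⁺ (UniqueDec.unique? _≟_)
    (subst (λ k → map (partner P) (elems (S P)) ∈ listsOver (elems (∁ (S P))) k)
           (length-map (partner P) (elems (S P)))
           (∈-listsOver (All.tabulate partner∈∁S)))
    (Unique-map-injectiveOn (partner P) (Unique-elems (S P))
       (λ i∈ j∈ → partner-injective P (∈-elems⁻ i∈) (∈-elems⁻ j∈)))
    where
    partner∈∁S : ∀ {j} → j ∈ map (partner P) (elems (S P)) → j ∈ elems (∁ (S P))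
    partner∈∁S j∈ with ∈-map⁻ (partner P) j∈
    ... | i , i∈ , refl = ∈-elems⁺ (x∉p⇒x∈∁p (partner∉S P (∈-elems⁻ i∈)))

meets⇒Admissible : ∀ {N r} {c : Fin N → Fin r} {S} → MeetsClasses c (allFin N) S → Admissible c S
meets⇒Admissible {c = c} meets a 2≤∣Ca∣ with two-members (Class c a) 2≤∣Ca∣
... | u , v , u≢v , u∈ , v∈
  with meets (∈-allFin u) (∈-allFin v) u≢v (trans (∈-Class⁻ c u∈) (sym (∈-Class⁻ c v∈)))
...   | i , i∈S , ci≡cu = i , i∈S , trans ci≡cu (∈-Class⁻ c u∈)

∈-allSubsets : ∀ {N} (S : Subset N) → S ∈ allSubsets N
∈-allSubsets S = ∈-vecsOver (VecAll.universal every-bit S)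
  where
  every-bit : ∀ b → b ∈ true ∷ false ∷ []
  every-bit true  = here refl
  every-bit false = there (here refl)

module Encoding {p n m r} (λv : Fin m → F₂^ n) (inΛ : InΛ (p + p) λv)
                (E : Fin (p + p) → Subset m) (c : Fin (p + p) → Fin r) where

  pairingOf : ∀ {a} → GoodTuple λv E a → AdmissiblePairing (lookup a) c (allFin (p + p))
  pairingOf {a} (_ , Σ≡0) =
    admissiblePairing (lookup a) c _ (allFin⁺ _) (evenness λv inΛ (lookup a) Σ≡0)

  encode : ∀ {a} → GoodTuple λv E a → Witness (p + p) m
  encode {a} g = S P , map (partner P) (elems (S P)) , map (lookup a) (elems (S P))
    where
    P : Pairing (lookup a) (allFin (p + p))
    P = proj₁ (pairingOf {a} g)

  encode∈witnesses : ∀ {a} (g : GoodTuple λv E a) → encode {a} g ∈ witnesses p E c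
  encode∈witnesses {a} g@(a∈E , _) =
    ∈-concat⁺′ (∈-concat⁺′ (∈-map⁺ _ values∈) (∈-map⁺ _ (partners∈bijections P)))
               (∈-map⁺ _ S∈good)
    where
    P : Pairing (lookup a) (allFin (p + p))
    P = proj₁ (pairingOf {a} g)
    ∣S∣≡p : ∣ S P ∣ ≡ p
    ∣S∣≡p = m+m≡n+n⇒m≡n (trans (sym (length≡∣S∣+∣S∣ P)) (length-tabulate id))
    S∈good : S P ∈ goodSubsets p c
    S∈good = ∈-filter⁺ _ (∈-allSubsets (S P)) (∣S∣≡p , meets⇒Admissible (proj₂ (pairingOf {a} g)))
    value∈common : ∀ {i} → i ∈ elems (S P) → lookup a i ∈ common E i (partner P i)
    value∈common {i} i∈ = ∈-elems⁺ (x∈p∩q⁺ (a∈E i , a[i]∈E[partner]))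
      where
      a[i]∈E[partner] : lookup a i ∈ₛ E (partner P i)
      a[i]∈E[partner] = subst (_∈ₛ E (partner P i)) (t∘partner P (∈-elems⁻ i∈)) (a∈E (partner P i))
    values∈ : map (lookup a) (elems (S P))
              ∈ choices (zipWith (common E) (elems (S P)) (map (partner P) (elems (S P))))
    values∈ = ∈-choices (Pointwise-map-zipWith (lookup a) (partner P) (common E) _ value∈common)

  encode-injective : ∀ {a a′} (g : GoodTuple λv E a) (g′ : GoodTuple λv E a′) →
                     encode {a} g ≡ encode {a′} g′ → a ≡ a′
  encode-injective {a} {a′} g g′ e =
    trans (sym (tabulate∘lookup a))
          (trans (tabulate-cong (λ j → pairing-determines P P′ S≡S′ partner≡ value≡ (∈-allFin j)))
                 (tabulate∘lookup a′))
    where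
    P : Pairing (lookup a) (allFin (p + p))
    P = proj₁ (pairingOf {a} g)
    P′ : Pairing (lookup a′) (allFin (p + p))
    P′ = proj₁ (pairingOf {a′} g′)
    S≡S′ : S P ≡ S P′
    S≡S′ = cong proj₁ e
    along-S : ∀ {B : Set} (f f′ : Fin (p + p) → B) →
              map f (elems (S P)) ≡ map f′ (elems (S P′)) → ∀ {i} → i ∈ₛ S P → f i ≡ f′ i
    along-S f f′ e′ i∈ =
      map≡map⇒≡ (trans e′ (cong (λ S → map f′ (elems S)) (sym S≡S′))) (∈-elems⁺ i∈)
    partner≡ : ∀ {i} → i ∈ₛ S P → partner P i ≡ partner P′ i
    partner≡ = along-S (partner P) (partner P′) (cong (proj₁ ∘ proj₂) e)
    value≡ : ∀ {i} → i ∈ₛ S P → lookup a i ≡ lookup a′ i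
    value≡ = along-S (lookup a) (lookup a′) (cong (proj₂ ∘ proj₂) e)

lemma20 : (p n m r : ℕ) → 1 ≤ p →
          (λv : Fin m → F₂^ n) → Injective _≡_ _≡_ λv → InΛ (p + p) λv →
          (E : Fin (p + p) → Subset m) →
          (c : Fin (p + p) → Fin r) →
          numTuples λv E ≤ RHS p E c
lemma20 p n m r _ λv _ inΛ E c = begin
  numTuples λv E
    ≤⟨ injection⇒length≤ unique (λ {a} a∈ → encode {a} (good a∈))
         (λ {a} a∈ → encode∈witnesses {a} (good a∈))
         (λ {a} {a′} a∈ a′∈ → encode-injective {a} {a′} (good a∈) (good a′∈)) ⟩
  length (witnesses p E c) ≡⟨ length-witnesses p E c ⟩
  RHS p E c                ∎
  where
  open ≤-Reasoning
  open Encoding {p} λv inΛ E c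
  tuples : List (Vec (Fin m) (p + p))
  tuples = vecsOver (allFin m) (p + p)
  unique : Unique (filter (goodTuple? λv E) tuples)
  unique = filter⁺ (goodTuple? λv E) (Unique-vecsOver (allFin⁺ m) (p + p))
  good : ∀ {a} → a ∈ filter (goodTuple? λv E) tuples → GoodTuple λv E a
  good a∈ = proj₂ (∈-filter⁻ (goodTuple? λv E) {xs = tuples} a∈)
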